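{- For every integer $n\ge 2$, the cyclic Haar graph $H(3n,\{0,1,n\})$ is unsplittable. Equivalently, the cyclic configurations defined by these graphs are unsplittable.
   Context: For a positive integer $m$ and $S\subseteq\mathbb{Z}_m$, the cyclic Haar graph $H(m,S)$ has vertex set $\{i^+: i\in\mathbb{Z}_m\}\cup\{i^-: i\in\mathbb{Z}_m\}$. Its edges join $i^+$ to $(i+k)^-$ for each $i\in\mathbb{Z}_m$ and each $k\in S$. The square $G^2$ of a graph $G$ joins two distinct vertices iff their distance in $G$ is at most 2. A connected graph $G$ is splittable if there is a set $\Sigma\subseteq V(G)$ that is independent in $G^2$ and such that $G-\Sigma$ is disconnected. It is unsplittable otherwise. A configuration is splittable or unsplittable according to its Levi graph (point–line incidence graph). -}

module Defs where

open import Data.Nat using (ℕ; zero; suc; _+_; _*_; _∸_; NonZero)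
open import Data.Nat.DivMod using (_%_)
open import Data.Fin using (Fin; toℕ)
open import Data.Bool using (Bool; true; false)
open import Data.Product using (Σ; ∃; _×_; _,_)
open import Data.Sum using (_⊎_)
open import Data.Unit using (⊤)
open import Data.Empty using (⊥)
open import Data.List using (List; [])
open import Data.List.Membership.Propositional using (_∈_)
open import Relation.Binary.PropositionalEquality using (_≡_)
open import Relation.Nullary using (¬_)
open import Level using (0ℓ)

record Graph : Set₁ where
  field
    V   : Set
    Adj : V → V → Set

open Graph public

data WalkIn (G : Graph) (P : V G → Set) : V G → V G → Set where
  here : ∀ {u} → P u → WalkIn G P u u
  step : ∀ {u w v} → P u → Adj G u w → WalkIn G P w v → WalkIn G P u v

Outside : (G : Graph) → (V G → Set) → V G → Set
Outside G Σ' x = ¬ Σ' x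

Everything : (G : Graph) → V G → Set
Everything G x = ⊤

Connected : Graph → Set
Connected G = ∀ (u v : V G) → WalkIn G (Everything G) u v

DisconnectedAfterRemoving : (G : Graph) → (V G → Set) → Set
DisconnectedAfterRemoving G S =
  Σ (V G) λ u → Σ (V G) λ v →
    ¬ S u × ¬ S v × ¬ WalkIn G (Outside G S) u v

Adj² : (G : Graph) → V G → V G → Set
Adj² G u v = ¬ (u ≡ v) × (Adj G u v ⊎ Σ (V G) λ w → Adj G u w × Adj G w v)

IndependentInSquare : (G : Graph) → (V G → Set) → Set
IndependentInSquare G S = ∀ u v → S u → S v → ¬ Adj² G u v

Splittable : Graph → Set₁
Splittable G = Connected G ×
  Σ (V G → Set) λ S → IndependentInSquare G S × DisconnectedAfterRemoving G S

Unsplittable : Graph → Set₁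
Unsplittable G = Connected G × ¬ Splittable G

-- Cyclic Haar graph H(m, S), S ⊆ ℤ_m given as a list of residues (as ℕ < m).
-- Vertices (true , i) = i⁺ and (false , i) = i⁻.
-- i⁺ ~ j⁻ iff (j - i) mod m ∈ S; adjacency taken symmetrically.
HaarAdj : (m : ℕ) → .{{NonZero m}} → List ℕ → Bool × Fin m → Bool × Fin m → Set
HaarAdj m S (true  , i) (false , j) = ((toℕ j + m ∸ toℕ i) % m) ∈ S
HaarAdj m S (false , j) (true  , i) = ((toℕ j + m ∸ toℕ i) % m) ∈ S
HaarAdj m S (true  , _) (true  , _) = ⊥
HaarAdj m S (false , _) (false , _) = ⊥

Haar : (m : ℕ) → .{{NonZero m}} → List ℕ → Graph
Haar m S = record { V = Bool × Fin m ; Adj = HaarAdj m S }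

module Submission where

-- Let S be independent in G², i.e. any two vertices of S are at distance ≥ 3.
-- A walk of G between two vertices outside S can be rerouted around every
-- vertex s ∈ S it passes through, provided any two neighbours of s are joined
-- by a walk avoiding S ("local detours").  All reasoning about membership in S
-- is classical, so walks are built in the double-negation monad; this suffices
-- because the goal, refuting a disconnection of G − S, is itself a negation.
--
-- Local detours come from a "hexagon lemma": if the neighbours of β i are
-- γ i, γ (τ i), γ (σ i) for commuting maps σ, τ with σ³ = 1 and σ, τ, σ²τ
-- fixed-point free, then inspecting S on γ (σ² i) and γ (σ τ i) always leaves a
-- path of length four between the neighbours.  In H(3n, {0, 1, n}) the upper
-- vertices i⁺ carry this layout with σ = +n, τ = +1 and the lower vertices i⁻
-- with σ = −n, τ = −1.

open import Defs
open import Data.List using (List; _∷_; [])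
open import Data.List.Membership.Propositional using (_∈_)
open import Data.List.Relation.Unary.Any using (here; there)
open import Data.Unit using (tt)
open import Data.Nat using (ℕ; zero; suc; _+_; _*_; _∸_; _≤_; _<_; z≤n; s≤s; z<s; NonZero; >-nonZero⁻¹)
open import Data.Nat.Tactic.RingSolver using (solve-∀)
open import Data.Nat.Properties using (+-comm; +-assoc; +-∸-assoc; m+[n∸m]≡n; <⇒≤; ≤-trans; <-trans; ≤-<-trans; m≤n+m; m≤m+n; m<m+n; n<1+n; *-identityˡ)
open import Data.Nat.DivMod using (_%_; m%n<n; m<n⇒m%n≡m; %-distribˡ-+; m%n%n≡m%n; [m+n]%n≡m%n; [m+kn]%n≡m%n; m*n%n≡0)
open import Data.Fin using (Fin; toℕ; fromℕ<)
open import Data.Fin.Properties using (toℕ-injective; toℕ-fromℕ<; toℕ<n)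
open import Data.Bool using (true; false)
open import Data.Product using (Σ; _×_; _,_; proj₁; proj₂)
open import Data.Sum using (_⊎_; inj₁; inj₂)
open import Data.Empty using (⊥; ⊥-elim)
open import Effect.Monad using (RawMonad)
open import Relation.Binary.PropositionalEquality
open import Relation.Nullary using (¬_; yes; no)
open import Relation.Nullary.Negation using (DoubleNegation; ¬¬-Monad)
open import Relation.Nullary.Decidable using (¬¬-excluded-middle)
open import Level using (0ℓ)

open RawMonad (¬¬-Monad {0ℓ}) using (pure; _>>=_; _<$>_)

module SimpleGraph (G : Graph)
  (symmetric : ∀ {u v} → Adj G u v → Adj G v u)
  (irreflexive : ∀ {u v} → Adj G u v → u ≢ v) where

  _▸_ : ∀ {P u v w} → WalkIn G P u v → WalkIn G P v w → WalkIn G P u w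
  here _ ▸ q = q
  step p e r ▸ q = step p e (r ▸ q)

  first : ∀ {P u v} → WalkIn G P u v → P u
  first (here p) = p
  first (step p _ _) = p

  reverse : ∀ {P u v} → WalkIn G P u v → WalkIn G P v u
  reverse (here p) = here p
  reverse (step p e r) = reverse r ▸ step (first r) (symmetric e) (here p)

  Avoiding : (V G → Set) → V G → V G → Set
  Avoiding S = WalkIn G (Outside G S)

  LocalDetours : (V G → Set) → Set
  LocalDetours S = ∀ {s u u′} → S s → Adj G s u → Adj G s u′ →
    DoubleNegation (Avoiding S u u′)

  module SquareIndependent {S : V G → Set} (independent : IndependentInSquare G S) where

    neighbour-outside : ∀ {s v} → S s → Adj G s v → ¬ S v
    neighbour-outside {s} {v} s∈S e v∈S =
      independent s v s∈S v∈S (irreflexive e , inj₁ e)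

    second-neighbour-outside : ∀ {s w v} → S s → Adj G s w → Adj G w v → s ≢ v → ¬ S v
    second-neighbour-outside {s} {w} {v} s∈S e e′ s≢v v∈S =
      independent s v s∈S v∈S (s≢v , inj₂ (w , e , e′))

    not-both : ∀ {w u v} → Adj G w u → Adj G w v → u ≢ v → S u → S v → ⊥
    not-both {w} {u} {v} e e′ u≢v u∈S v∈S =
      independent u v u∈S v∈S (u≢v , inj₂ (w , symmetric e , e′))

    module Rerouting (detour : LocalDetours S) where

      reroute : ∀ {u v} → ¬ S u → WalkIn G (Everything G) u v → ¬ S v →
        DoubleNegation (Avoiding S u v)
      bypass : ∀ {u w v} → Adj G u w → S w → WalkIn G (Everything G) w v → ¬ S v →
        DoubleNegation (Avoiding S u v)

      reroute u∉S (here _) _ = pure (here u∉S)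
      reroute u∉S (step {w = w} _ e rest) v∉S = ¬¬-excluded-middle {A = S w} >>= λ where
        (yes w∈S) → bypass e w∈S rest v∉S
        (no w∉S)  → step u∉S e <$> reroute w∉S rest v∉S

      bypass _ w∈S (here _) v∉S = ⊥-elim (v∉S w∈S)
      bypass e w∈S (step _ e′ rest) v∉S =
        detour w∈S (symmetric e) e′ >>= λ around →
        (around ▸_) <$> reroute (neighbour-outside w∈S e′) rest v∉S

  record Hexagonal (X : Set) : Set where
    field
      β γ         : X → V G
      β-injective : ∀ {x y} → β x ≡ β y → x ≡ y
      γ-injective : ∀ {x y} → γ x ≡ γ y → x ≡ y
      σ τ         : X → X
      σ³          : ∀ x → σ (σ (σ x)) ≡ x
      σ-τ-commute : ∀ x → σ (τ x) ≡ τ (σ x)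
      σ-moves     : ∀ x → σ x ≢ x
      τ-moves     : ∀ x → τ x ≢ x
      σ²τ-moves   : ∀ x → σ (σ (τ x)) ≢ x
      edge        : ∀ x → Adj G (β x) (γ x)
      edge-τ      : ∀ x → Adj G (β x) (γ (τ x))
      edge-σ      : ∀ x → Adj G (β x) (γ (σ x))
      neighbours  : ∀ x {v} → Adj G (β x) v → v ≡ γ x ⊎ v ≡ γ (τ x) ⊎ v ≡ γ (σ x)

  module HexagonLemma {X : Set} (H : Hexagonal X)
    {S : V G → Set} (independent : IndependentInSquare G S) where
    open Hexagonal H
    open SquareIndependent independent

    σ²-moves : ∀ x → σ (σ x) ≢ x
    σ²-moves x σ²x≡x = σ-moves (σ (σ x)) (trans (σ³ x) (sym σ²x≡x))

    σ²τ≡τσ² : ∀ x → σ (σ (τ x)) ≡ τ (σ (σ x))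
    σ²τ≡τσ² x = trans (cong σ (σ-τ-commute x)) (σ-τ-commute (σ x))

    edge-τ≡ : ∀ x {y} → y ≡ τ x → Adj G (β x) (γ y)
    edge-τ≡ x y≡τx = subst (λ y → Adj G (β x) (γ y)) (sym y≡τx) (edge-τ x)

    edge-σ⁻¹ : ∀ x → Adj G (β (σ (σ x))) (γ x)
    edge-σ⁻¹ x = subst (λ y → Adj G (β (σ (σ x))) (γ y)) (σ³ x) (edge-σ (σ (σ x)))

    -- The walks below live in the subgraph spanned by γ i, γ (τ i), γ (σ i)
    -- (the neighbours of β i ∈ S), the vertices β (σ i), β (σ² i), β (τ i),
    -- β (σ² τ i) at distance two from β i, and γ (σ² i), γ (σ τ i),
    -- γ (σ² τ i), of which S contains at most one.
    module Around {i : X} (βi∈S : S (β i)) where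

      β-apart : ∀ {x} → x ≢ i → β i ≢ β x
      β-apart x≢i βi≡βx = x≢i (sym (β-injective βi≡βx))

      γ-apart : ∀ {x y} → x ≢ y → γ x ≢ γ y
      γ-apart x≢y γx≡γy = x≢y (γ-injective γx≡γy)

      γi∉S : ¬ S (γ i)
      γi∉S = neighbour-outside βi∈S (edge i)
      γτi∉S : ¬ S (γ (τ i))
      γτi∉S = neighbour-outside βi∈S (edge-τ i)
      γσi∉S : ¬ S (γ (σ i))
      γσi∉S = neighbour-outside βi∈S (edge-σ i)

      βσi∉S : ¬ S (β (σ i))
      βσi∉S = second-neighbour-outside βi∈S (edge-σ i) (symmetric (edge (σ i)))
        (β-apart (σ-moves i))
      βσ²i∉S : ¬ S (β (σ (σ i)))
      βσ²i∉S = second-neighbour-outside βi∈S (edge i) (symmetric (edge-σ⁻¹ i))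
        (β-apart (σ²-moves i))
      βτi∉S : ¬ S (β (τ i))
      βτi∉S = second-neighbour-outside βi∈S (edge-τ i) (symmetric (edge (τ i)))
        (β-apart (τ-moves i))
      βσ²τi∉S : ¬ S (β (σ (σ (τ i))))
      βσ²τi∉S = second-neighbour-outside βi∈S (edge-τ i) (symmetric (edge-σ⁻¹ (τ i)))
        (β-apart (σ²τ-moves i))

      via-γσ²i : ¬ S (γ (σ (σ i))) → Avoiding S (γ i) (γ (σ i))
      via-γσ²i γσ²i∉S =
        step γi∉S   (symmetric (edge-σ⁻¹ i)) (
        step βσ²i∉S (edge (σ (σ i))) (
        step γσ²i∉S (symmetric (edge-σ (σ i))) (
        step βσi∉S  (edge (σ i)) (
        here γσi∉S))))

      via-γσ²τi : ¬ S (γ (σ (σ (τ i)))) → Avoiding S (γ i) (γ (τ i))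
      via-γσ²τi γσ²τi∉S =
        step γi∉S    (symmetric (edge-σ⁻¹ i)) (
        step βσ²i∉S  (edge-τ≡ (σ (σ i)) (σ²τ≡τσ² i)) (
        step γσ²τi∉S (symmetric (edge (σ (σ (τ i))))) (
        step βσ²τi∉S (edge-σ⁻¹ (τ i)) (
        here γτi∉S))))

      via-γστi : ¬ S (γ (σ (τ i))) → Avoiding S (γ (σ i)) (γ (τ i))
      via-γστi γστi∉S =
        step γσi∉S  (symmetric (edge (σ i))) (
        step βσi∉S  (edge-τ≡ (σ i) (σ-τ-commute i)) (
        step γστi∉S (symmetric (edge-σ (τ i))) (
        step βτi∉S  (edge (τ i)) (
        here γτi∉S))))

      -- Each pair among γ σ²i, γ στi, γ σ²τi has a common neighbour.
      σ²i-excludes-σ²τi : S (γ (σ (σ i))) → ¬ S (γ (σ (σ (τ i))))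
      σ²i-excludes-σ²τi = not-both (edge (σ (σ i))) (edge-τ≡ (σ (σ i)) (σ²τ≡τσ² i))
        (γ-apart λ σ²i≡σ²τi → τ-moves (σ (σ i)) (sym (trans σ²i≡σ²τi (σ²τ≡τσ² i))))

      σ²i-excludes-στi : S (γ (σ (σ i))) → ¬ S (γ (σ (τ i)))
      σ²i-excludes-στi = not-both (edge-σ (σ i)) (edge-τ≡ (σ i) (σ-τ-commute i))
        (γ-apart λ σ²i≡στi → σ²τ-moves i (sym (trans (sym (σ³ i)) (cong σ σ²i≡στi))))

      στi-excludes-σ²τi : S (γ (σ (τ i))) → ¬ S (γ (σ (σ (τ i))))
      στi-excludes-σ²τi = not-both (edge (σ (τ i))) (edge-σ (σ (τ i)))
        (γ-apart λ στi≡σ²τi → σ-moves (σ (τ i)) (sym στi≡σ²τi))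

      joined : DoubleNegation (Avoiding S (γ i) (γ (τ i)) × Avoiding S (γ i) (γ (σ i)))
      joined = ¬¬-excluded-middle {A = S (γ (σ (σ i)))} >>= λ where
        (yes γσ²i∈S) →
          let to-τi = via-γσ²τi (σ²i-excludes-σ²τi γσ²i∈S)
          in pure (to-τi , to-τi ▸ reverse (via-γστi (σ²i-excludes-στi γσ²i∈S)))
        (no γσ²i∉S) → ¬¬-excluded-middle {A = S (γ (σ (τ i)))} >>= λ where
          (yes γστi∈S) → pure (via-γσ²τi (στi-excludes-σ²τi γστi∈S) , via-γσ²i γσ²i∉S)
          (no γστi∉S)  → pure (via-γσ²i γσ²i∉S ▸ via-γστi γστi∉S , via-γσ²i γσ²i∉S)

      joined-to-γi : ∀ {v} → Adj G (β i) v → DoubleNegation (Avoiding S (γ i) v)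
      joined-to-γi e with neighbours i e
      ... | inj₁ refl        = pure (here γi∉S)
      ... | inj₂ (inj₁ refl) = proj₁ <$> joined
      ... | inj₂ (inj₂ refl) = proj₂ <$> joined

    detours : ∀ {i u u′} → S (β i) → Adj G (β i) u → Adj G (β i) u′ →
      DoubleNegation (Avoiding S u u′)
    detours βi∈S e e′ =
      joined-to-γi e >>= λ r → (reverse r ▸_) <$> joined-to-γi e′
      where open Around βi∈S

  unsplittable-by-local-detours : Connected G →
    (∀ S → IndependentInSquare G S → LocalDetours S) → Unsplittable G
  unsplittable-by-local-detours connected detours =
    connected , λ (_ , S , independent , u , v , u∉S , v∉S , no-walk) →
      let open SquareIndependent independent
          open Rerouting (detours S independent)
      in reroute u∉S (connected u v) v∉S no-walk

module Cyclic (m : ℕ) .{{_ : NonZero m}} where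
  open ≡-Reasoning

  shift : ℕ → Fin m → Fin m
  shift d x = fromℕ< (m%n<n (toℕ x + d) m)

  difference : Fin m → Fin m → ℕ
  difference x y = (toℕ y + m ∸ toℕ x) % m

  toℕ-shift : ∀ d x → toℕ (shift d x) ≡ (toℕ x + d) % m
  toℕ-shift d x = toℕ-fromℕ< _

  toℕ-mod : ∀ (x : Fin m) → toℕ x % m ≡ toℕ x
  toℕ-mod x = m<n⇒m%n≡m (toℕ<n x)

  %-absorbˡ : ∀ a b → (a % m + b) % m ≡ (a + b) % m
  %-absorbˡ a b = begin
    (a % m + b) % m          ≡⟨ %-distribˡ-+ (a % m) b m ⟩
    (a % m % m + b % m) % m  ≡⟨ cong (λ z → (z + b % m) % m) (m%n%n≡m%n a m) ⟩
    (a % m + b % m) % m      ≡⟨ %-distribˡ-+ a b m ⟨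
    (a + b) % m              ∎

  %-absorbʳ : ∀ a b → (a + b % m) % m ≡ (a + b) % m
  %-absorbʳ a b = begin
    (a + b % m) % m  ≡⟨ cong (_% m) (+-comm a (b % m)) ⟩
    (b % m + a) % m  ≡⟨ %-absorbˡ b a ⟩
    (b + a) % m      ≡⟨ cong (_% m) (+-comm b a) ⟩
    (a + b) % m      ∎

  shift-shift : ∀ d e x → shift d (shift e x) ≡ shift (e + d) x
  shift-shift d e x = toℕ-injective (begin
    toℕ (shift d (shift e x))  ≡⟨ toℕ-shift d (shift e x) ⟩
    (toℕ (shift e x) + d) % m  ≡⟨ cong (λ z → (z + d) % m) (toℕ-shift e x) ⟩
    ((toℕ x + e) % m + d) % m  ≡⟨ %-absorbˡ (toℕ x + e) d ⟩
    (toℕ x + e + d) % m        ≡⟨ cong (_% m) (+-assoc (toℕ x) e d) ⟩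
    (toℕ x + (e + d)) % m      ≡⟨ toℕ-shift (e + d) x ⟨
    toℕ (shift (e + d) x)      ∎)

  shift-commute : ∀ d e x → shift d (shift e x) ≡ shift e (shift d x)
  shift-commute d e x = begin
    shift d (shift e x)  ≡⟨ shift-shift d e x ⟩
    shift (e + d) x      ≡⟨ cong (λ z → shift z x) (+-comm e d) ⟩
    shift (d + e) x      ≡⟨ shift-shift e d x ⟨
    shift e (shift d x)  ∎

  shift-multiple : ∀ q x → shift (q * m) x ≡ x
  shift-multiple q x = toℕ-injective (begin
    toℕ (shift (q * m) x)  ≡⟨ toℕ-shift (q * m) x ⟩
    (toℕ x + q * m) % m    ≡⟨ [m+kn]%n≡m%n (toℕ x) q m ⟩
    toℕ x % m              ≡⟨ toℕ-mod x ⟩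
    toℕ x                  ∎)

  shift-zero : ∀ x → shift 0 x ≡ x
  shift-zero = shift-multiple 0

  shift-cancel : ∀ {d e} q → d + e ≡ q * m → ∀ x → shift e (shift d x) ≡ x
  shift-cancel {d} {e} q d+e≡qm x = begin
    shift e (shift d x)  ≡⟨ shift-shift e d x ⟩
    shift (d + e) x      ≡⟨ cong (λ z → shift z x) d+e≡qm ⟩
    shift (q * m) x      ≡⟨ shift-multiple q x ⟩
    x                    ∎

  shift-cancel′ : ∀ {d e} q → d + e ≡ q * m → ∀ x → shift d (shift e x) ≡ x
  shift-cancel′ {d} {e} q d+e≡qm x = trans (shift-commute d e x) (shift-cancel q d+e≡qm x)

  shift-shift-shift : ∀ a b c x → shift a (shift b (shift c x)) ≡ shift (c + b + a) x
  shift-shift-shift a b c x = trans (cong (shift a) (shift-shift b c x)) (shift-shift a (c + b) x)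

  shift-order-3 : ∀ {d} q → d + d + d ≡ q * m → ∀ x → shift d (shift d (shift d x)) ≡ x
  shift-order-3 {d} q 3d≡qm x =
    trans (cong (shift d) (shift-shift d d x)) (shift-cancel q 3d≡qm x)

  difference-shift : ∀ d x → difference x (shift d x) ≡ d % m
  difference-shift d x = begin
    (toℕ (shift d x) + m ∸ toℕ x) % m    ≡⟨ cong (_% m) (+-∸-assoc (toℕ (shift d x)) x≤m) ⟩
    (toℕ (shift d x) + (m ∸ toℕ x)) % m  ≡⟨ cong (λ z → (z + (m ∸ toℕ x)) % m) (toℕ-shift d x) ⟩
    ((toℕ x + d) % m + (m ∸ toℕ x)) % m  ≡⟨ %-absorbˡ (toℕ x + d) (m ∸ toℕ x) ⟩
    (toℕ x + d + (m ∸ toℕ x)) % m        ≡⟨ cong (λ z → (z + (m ∸ toℕ x)) % m) (+-comm (toℕ x) d) ⟩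
    (d + toℕ x + (m ∸ toℕ x)) % m        ≡⟨ cong (_% m) (+-assoc d (toℕ x) (m ∸ toℕ x)) ⟩
    (d + (toℕ x + (m ∸ toℕ x))) % m      ≡⟨ cong (λ z → (d + z) % m) (m+[n∸m]≡n x≤m) ⟩
    (d + m) % m                          ≡⟨ [m+n]%n≡m%n d m ⟩
    d % m                                ∎
    where x≤m = <⇒≤ (toℕ<n x)

  shift-difference : ∀ x y → shift (difference x y) x ≡ y
  shift-difference x y = toℕ-injective (begin
    toℕ (shift (difference x y) x)          ≡⟨ toℕ-shift (difference x y) x ⟩
    (toℕ x + (toℕ y + m ∸ toℕ x) % m) % m  ≡⟨ %-absorbʳ (toℕ x) (toℕ y + m ∸ toℕ x) ⟩
    (toℕ x + (toℕ y + m ∸ toℕ x)) % m      ≡⟨ cong (_% m) (m+[n∸m]≡n x≤y+m) ⟩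
    (toℕ y + m) % m                        ≡⟨ [m+n]%n≡m%n (toℕ y) m ⟩
    toℕ y % m                              ≡⟨ toℕ-mod y ⟩
    toℕ y                                  ∎)
    where x≤y+m = ≤-trans (<⇒≤ (toℕ<n x)) (m≤n+m m (toℕ y))

  shift-moves : ∀ {d r} → d % m ≡ suc r → ∀ x → shift d x ≢ x
  shift-moves {d} {r} d%m≡1+r x shift-d-x≡x = 1+r≢0 (begin
    suc r                       ≡⟨ d%m≡1+r ⟨
    d % m                       ≡⟨ difference-shift d x ⟨
    difference x (shift d x)    ≡⟨ cong (difference x) (trans shift-d-x≡x (sym (shift-zero x))) ⟩
    difference x (shift 0 x)    ≡⟨ difference-shift 0 x ⟩
    0 % m                       ≡⟨ m*n%n≡0 0 m ⟩
    0                           ∎)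
    where 1+r≢0 : suc r ≢ 0
          1+r≢0 ()

module CyclicHaar (m : ℕ) .{{_ : NonZero m}} (L : List ℕ) where
  open Cyclic m

  H : Graph
  H = Haar m L

  haar-symmetric : ∀ {u v} → Adj H u v → Adj H v u
  haar-symmetric {true  , _} {false , _} e = e
  haar-symmetric {false , _} {true  , _} e = e

  haar-irreflexive : ∀ {u v} → Adj H u v → u ≢ v
  haar-irreflexive {true  , _} {false , _} _ ()
  haar-irreflexive {false , _} {true  , _} _ ()

  open SimpleGraph H haar-symmetric haar-irreflexive public

  haar-edge : ∀ {d} → d < m → d ∈ L → ∀ x → Adj H (true , x) (false , shift d x)
  haar-edge {d} d<m d∈L x =
    subst (_∈ L) (sym (trans (difference-shift d x) (m<n⇒m%n≡m d<m))) d∈L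

  vertical-edge : 0 ∈ L → ∀ x → Adj H (true , x) (false , x)
  vertical-edge 0∈L x = subst (λ y → Adj H (true , x) (false , y)) (shift-zero x)
    (haar-edge (>-nonZero⁻¹ m) 0∈L x)

  haar-edge⁻ : ∀ {d} → d < m → d ∈ L → ∀ x → Adj H (false , shift d x) (true , x)
  haar-edge⁻ {d} d<m d∈L x = haar-symmetric {true , x} {false , shift d x} (haar-edge d<m d∈L x)

  vertical-edge⁻ : 0 ∈ L → ∀ x → Adj H (false , x) (true , x)
  vertical-edge⁻ 0∈L x = haar-symmetric {true , x} {false , x} (vertical-edge 0∈L x)

  haar-neighbour : ∀ x y → Adj H (true , x) (false , y) →
    Σ ℕ λ d → d ∈ L × y ≡ shift d x
  haar-neighbour x y e = difference x y , e , sym (shift-difference x y)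

  -- With 0, 1 ∈ L, every x⁺ reaches (x + 1)⁺ through (x + 1)⁻, so the
  -- graph is connected.
  haar-connected : 0 ∈ L → 1 ∈ L → 1 < m → Connected H
  haar-connected 0∈L 1∈L 1<m u v = to-upper u ▸ (across (proj₂ u) (proj₂ v) ▸ reverse (to-upper v))
    where
    Walk : V H → V H → Set
    Walk = WalkIn H (Everything H)

    to-upper : ∀ w → Walk w (true , proj₂ w)
    to-upper (true  , x) = here tt
    to-upper (false , x) = step tt (vertical-edge⁻ 0∈L x) (here tt)

    rise : ∀ x → Walk (true , x) (true , shift 1 x)
    rise x = step {w = false , shift 1 x} tt (haar-edge 1<m 1∈L x)
      (step tt (vertical-edge⁻ 0∈L (shift 1 x)) (here tt))

    climb : ∀ j x → Walk (true , x) (true , shift j x)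
    climb zero x = subst (λ y → Walk (true , x) (true , y)) (sym (shift-zero x)) (here tt)
    climb (suc j) x = rise x ▸
      subst (λ y → Walk (true , shift 1 x) (true , y)) (shift-shift j 1 x) (climb j (shift 1 x))

    across : ∀ x y → Walk (true , x) (true , y)
    across x y = subst (λ z → Walk (true , x) (true , z)) (shift-difference x y) (climb (difference x y) x)

3n≡m : ∀ k → (2 + k + (2 + k)) + (2 + k) ≡ 1 * (3 * (2 + k))
3n≡m = solve-∀

6n≡2m : ∀ k → ((2 + k + (2 + k)) + (2 + k + (2 + k))) + (2 + k + (2 + k)) ≡ 2 * (3 * (2 + k))
6n≡2m = solve-∀

[m-1]+1≡m : ∀ k → (2 + k + (2 + k) + suc k) + 1 ≡ 1 * (3 * (2 + k))
[m-1]+1≡m = solve-∀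

[m-1]+4n≡[n-1]+2m : ∀ k → (2 + k + (2 + k) + suc k) + (2 + k + (2 + k)) + (2 + k + (2 + k))
  ≡ suc k + 2 * (3 * (2 + k))
[m-1]+4n≡[n-1]+2m = solve-∀

-- The graph H(3n, {0, 1, n}) for n = 2 + k.  Its upper vertices carry the
-- hexagonal layout σ = +n, τ = +1, its lower vertices the layout
-- σ = −n = +2n, τ = −1 = +(3n − 1).
module HaarTriangle (k : ℕ) where
  n m m-1 : ℕ
  n   = 2 + k
  m   = 3 * n
  m-1 = n + n + suc k

  L : List ℕ
  L = 0 ∷ 1 ∷ n ∷ []

  open Cyclic m
  open CyclicHaar m L

  m-1<m : m-1 < m
  m-1<m = subst (m-1 <_) (trans ([m-1]+1≡m k) (*-identityˡ m)) (m<m+n m-1 z<s)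
  2n+1<m : suc (n + n) < m
  2n+1<m = ≤-<-trans (m<m+n (n + n) z<s) m-1<m
  2n<m : n + n < m
  2n<m = <-trans (n<1+n (n + n)) 2n+1<m
  n<m : n < m
  n<m = ≤-<-trans (m≤m+n n n) 2n<m
  1<m : 1 < m
  1<m = ≤-<-trans (s≤s z≤n) n<m
  n-1<m : suc k < m
  n-1<m = <-trans (n<1+n (suc k)) n<m

  offsets : ∀ {d} → d ∈ L → d ≡ 0 ⊎ d ≡ 1 ⊎ d ≡ n
  offsets (here d≡0)                 = inj₁ d≡0
  offsets (there (here d≡1))         = inj₂ (inj₁ d≡1)
  offsets (there (there (here d≡n))) = inj₂ (inj₂ d≡n)

  upper : Hexagonal (Fin m)
  upper = record
    { β = true ,_
    ; γ = false ,_
    ; β-injective = cong proj₂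
    ; γ-injective = cong proj₂
    ; σ = shift n
    ; τ = shift 1
    ; σ³ = shift-order-3 1 (3n≡m k)
    ; σ-τ-commute = shift-commute n 1
    ; σ-moves = shift-moves (m<n⇒m%n≡m n<m)
    ; τ-moves = shift-moves (m<n⇒m%n≡m 1<m)
    ; σ²τ-moves = λ x → subst (_≢ x) (sym (shift-shift-shift n n 1 x))
        (shift-moves (m<n⇒m%n≡m 2n+1<m) x)
    ; edge = vertical-edge (here refl)
    ; edge-τ = haar-edge 1<m (there (here refl))
    ; edge-σ = haar-edge n<m (there (there (here refl)))
    ; neighbours = neighbours
    }
    where
    neighbours : ∀ x {v} → Adj H (true , x) v →
      v ≡ (false , x) ⊎ v ≡ (false , shift 1 x) ⊎ v ≡ (false , shift n x)
    neighbours x {false , y} e with haar-neighbour x y e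
    ... | d , d∈L , y≡x+d with offsets d∈L
    ... | inj₁ refl        = inj₁ (cong (false ,_) (trans y≡x+d (shift-zero x)))
    ... | inj₂ (inj₁ refl) = inj₂ (inj₁ (cong (false ,_) y≡x+d))
    ... | inj₂ (inj₂ refl) = inj₂ (inj₂ (cong (false ,_) y≡x+d))

  lower : Hexagonal (Fin m)
  lower = record
    { β = false ,_
    ; γ = true ,_
    ; β-injective = cong proj₂
    ; γ-injective = cong proj₂
    ; σ = shift (n + n)
    ; τ = shift m-1
    ; σ³ = shift-order-3 2 (6n≡2m k)
    ; σ-τ-commute = shift-commute (n + n) m-1
    ; σ-moves = shift-moves (m<n⇒m%n≡m 2n<m)
    ; τ-moves = shift-moves (m<n⇒m%n≡m m-1<m)
    ; σ²τ-moves = λ x → subst (_≢ x) (sym (shift-shift-shift (n + n) (n + n) m-1 x))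
        (shift-moves σ²τ-offset x)
    ; edge = vertical-edge⁻ (here refl)
    ; edge-τ = λ x → subst (λ y → Adj H (false , y) (true , shift m-1 x))
        (shift-cancel 1 ([m-1]+1≡m k) x) (haar-edge⁻ 1<m (there (here refl)) (shift m-1 x))
    ; edge-σ = λ x → subst (λ y → Adj H (false , y) (true , shift (n + n) x))
        (shift-cancel 1 (3n≡m k) x) (haar-edge⁻ n<m (there (there (here refl))) (shift (n + n) x))
    ; neighbours = neighbours
    }
    where
    -- σ²τ = −2n − 1 ≡ n − 1, which is nonzero as n ≥ 2
    σ²τ-offset : (m-1 + (n + n) + (n + n)) % m ≡ suc k
    σ²τ-offset = begin
      (m-1 + (n + n) + (n + n)) % m  ≡⟨ cong (_% m) ([m-1]+4n≡[n-1]+2m k) ⟩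
      (suc k + 2 * m) % m            ≡⟨ [m+kn]%n≡m%n (suc k) 2 m ⟩
      suc k % m                      ≡⟨ m<n⇒m%n≡m n-1<m ⟩
      suc k                          ∎
      where open ≡-Reasoning

    -- x⁻'s neighbours: if x = y + d with d ∈ {0, 1, n} then y = x − d
    neighbours : ∀ x {v} → Adj H (false , x) v →
      v ≡ (true , x) ⊎ v ≡ (true , shift m-1 x) ⊎ v ≡ (true , shift (n + n) x)
    neighbours x {true , y} e with haar-neighbour y x e
    ... | d , d∈L , x≡y+d with offsets d∈L
    ... | inj₁ refl        = inj₁ (cong (true ,_) (sym (trans x≡y+d (shift-zero y))))
    ... | inj₂ (inj₁ refl) = inj₂ (inj₁ (cong (true ,_)
          (sym (trans (cong (shift m-1) x≡y+d) (shift-cancel′ 1 ([m-1]+1≡m k) y)))))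
    ... | inj₂ (inj₂ refl) = inj₂ (inj₂ (cong (true ,_)
          (sym (trans (cong (shift (n + n)) x≡y+d) (shift-cancel′ 1 (3n≡m k) y)))))

  local-detours : ∀ S → IndependentInSquare H S → LocalDetours S
  local-detours S independent {true  , i} = HexagonLemma.detours upper independent {i = i}
  local-detours S independent {false , i} = HexagonLemma.detours lower independent {i = i}

theorem10 : (n : ℕ) → 2 ≤ n → .{{_ : NonZero (3 * n)}} →
    Unsplittable (Haar (3 * n) (0 ∷ 1 ∷ n ∷ []))
theorem10 (suc (suc k)) (s≤s (s≤s z≤n)) =
  unsplittable-by-local-detours (haar-connected (here refl) (there (here refl)) 1<m) local-detours
  where open HaarTriangle k
        open CyclicHaar m L
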